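{- Let $n \ge 1$ and $m$ be integers with $0 \le m \le n(n-1)$, and let $t = \lceil m/n \rceil$. Define $F(m,n)$ to be the minimum of $$\sum_{i=1}^n \left( \binom{s_i+1}{2} + (n-i)\,t_i \right)$$ over all nonnegative integers $s_1,\dots,s_n,t_1,\dots,t_n$ satisfying $s_i \le n-i$ and $t_i \le n-i$ for all $i$, and $\sum_{i=1}^n s_i + \sum_{i=1}^n t_i = m$. Then $F(m,n) = tm - (t^2-t)n/2$. -}

module Defs where

open import Data.Nat using (ℕ; suc; _+_; _*_; _∸_; _≤_; NonZero)
open import Data.Nat.DivMod using (_/_)
open import Data.Nat.Combinatorics using (_C_)
open import Data.Fin using (Fin; toℕ)
open import Data.Vec using (sum; tabulate)
open import Data.Product using (_×_; Σ; ∃)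

-- Index i ∈ {1,…,n} is represented by k : Fin n with i = toℕ k + 1,
-- so that n - i = n ∸ suc (toℕ k).

⌈_/_⌉ : (m n : ℕ) → .{{NonZero n}} → ℕ
⌈ m / n ⌉ = (m + (n ∸ 1)) / n

Σ[_] : (n : ℕ) → (Fin n → ℕ) → ℕ
Σ[ n ] f = sum (tabulate f)

Feasible : (n m : ℕ) → (s t : Fin n → ℕ) → Set
Feasible n m s t =
  ((k : Fin n) → s k ≤ n ∸ suc (toℕ k)) ×
  ((k : Fin n) → t k ≤ n ∸ suc (toℕ k)) ×
  (Σ[ n ] s + Σ[ n ] t ≡ m)
  where open import Relation.Binary.PropositionalEquality using (_≡_)

Cost : (n : ℕ) → (s t : Fin n → ℕ) → ℕ
Cost n s t = Σ[ n ] (λ k → (suc (s k) C 2) + (n ∸ suc (toℕ k)) * t k)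

-- "F(m,n) = v": v is the minimum of Cost over feasible (s,t):
-- attained by some feasible pair, and a lower bound for all feasible pairs.
FIs : (m n v : ℕ) → Set
FIs m n v =
  (Σ (Fin n → ℕ) λ s → Σ (Fin n → ℕ) λ t → Feasible n m s t × Cost n s t ≡ v) ×
  ((s t : Fin n → ℕ) → Feasible n m s t → v ≤ Cost n s t)
  where open import Relation.Binary.PropositionalEquality using (_≡_)

-- For every level T ≤ n and every capped pair (s,t)
--   T · (Σ s + Σ t) ≤ Cost(s,t) + n · C(T,2).
-- By induction on n, peeling off the first index (cap n−1): if T ≤ n−1 the
-- head contributes T·s₀ ≤ C(s₀+1,2) + C(T,2) and T·t₀ ≤ (n−1)·t₀; if T = n
-- we use the bound for level n−1 together with Σ s, Σ t ≤ C(n,2).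
--
-- Writing m = n·T + a with a ≤ n, an explicit feasible pair
-- of cost n·C(T+1,2) + a·(T+1) is built index by index: the first index
-- takes s₀ = T or T+1, and once the remaining caps are too small every
-- variable is filled up to its cap.
--
-- For T = ⌈m/n⌉ this cost equals T·m − n·C(T,2), so the two bounds meet;
-- and ⌊(T²−T)·n/2⌋ = n·C(T,2) identifies this with the stated value.
module Submission where

open import Defs
open import Data.Nat using (ℕ; NonZero; _*_; _∸_; _≤_; ⌊_/2⌋)
open import Data.Nat.Base using (zero; suc; _+_; _<_; z≤n; s≤s; z<s)
open import Data.Nat.Properties
open import Data.Nat.DivMod using (_/_; _%_; m≡m%n+[m/n]*n; m%n<n; m<n⇒m/n≡0; m*n/n≡m; +-distrib-/-∣ʳ)
open import Data.Nat.Divisibility using (divides-refl)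
open import Data.Nat.Combinatorics using (_C_; nCk+nC[k+1]≡[n+1]C[k+1]; nC1≡n)
open import Data.Nat.Tactic.RingSolver using (solve-∀)
open import Data.Fin using (Fin; toℕ)
import Data.Fin as Fin
open import Data.Vec.Functional using (tail)
import Data.Vec.Functional as Vector
open import Data.Product using (_×_; Σ; _,_)
open import Data.Sum using (inj₁; inj₂)
open import Function using (_∘_)
open import Relation.Binary.PropositionalEquality

C2-suc : ∀ n → suc n C 2 ≡ n + n C 2
C2-suc n = trans (sym (nCk+nC[k+1]≡[n+1]C[k+1] n 1)) (cong (_+ n C 2) (nC1≡n n))

C2-twice : ∀ n → suc n C 2 + suc n C 2 ≡ suc n * n
C2-twice zero = refl
C2-twice (suc n) = begin
  suc (suc n) C 2 + suc (suc n) C 2  ≡⟨ cong (λ c → c + c) (C2-suc (suc n)) ⟩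
  (suc n + c) + (suc n + c)          ≡⟨ regroup (suc n) c ⟩
  suc n + suc n + (c + c)            ≡⟨ cong (suc n + suc n +_) (C2-twice n) ⟩
  suc n + suc n + suc n * n          ≡⟨ expand n ⟩
  suc (suc n) * suc n                ∎
  where
  open ≡-Reasoning
  c : ℕ
  c = suc n C 2
  regroup : ∀ x c → (x + c) + (x + c) ≡ x + x + (c + c)
  regroup = solve-∀
  expand : ∀ n → suc n + suc n + suc n * n ≡ suc (suc n) * suc n
  expand = solve-∀

C2-double : ∀ T → T C 2 + T C 2 + T ≡ T * T
C2-double zero = refl
C2-double (suc n) = begin
  suc n C 2 + suc n C 2 + suc n  ≡⟨ cong (_+ suc n) (C2-twice n) ⟩
  suc n * n + suc n              ≡⟨ +-comm (suc n * n) (suc n) ⟩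
  suc n + suc n * n              ≡⟨ *-suc (suc n) n ⟨
  suc n * suc n                  ∎
  where open ≡-Reasoning

half-level : ∀ T n → ⌊ (T * T ∸ T) * n /2⌋ ≡ n * (T C 2)
half-level T n = begin
  ⌊ (T * T ∸ T) * n /2⌋          ≡⟨ cong (λ x → ⌊ (x ∸ T) * n /2⌋) (sym (C2-double T)) ⟩
  ⌊ (c + c + T ∸ T) * n /2⌋      ≡⟨ cong (λ x → ⌊ x * n /2⌋) (m+n∸n≡m (c + c) T) ⟩
  ⌊ (c + c) * n /2⌋              ≡⟨ cong ⌊_/2⌋ (distrib c n) ⟩
  ⌊ n * c + n * c /2⌋            ≡⟨ sym (n≡⌊n+n/2⌋ (n * c)) ⟩
  n * c                          ∎
  where
  open ≡-Reasoning
  c : ℕ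
  c = T C 2
  distrib : ∀ c n → (c + c) * n ≡ n * c + n * c
  distrib = solve-∀

-- T·s ≤ C(s+1,2) + C(T,2), with equality iff s ∈ {T−1, T}; this is
-- (s−T)(s−T+1) ≥ 0 in disguise, and bounds the s-part of the cost.
triangle-bound : ∀ T s → T * s ≤ suc s C 2 + T C 2
triangle-bound zero s = z≤n
triangle-bound (suc T) zero = ≤-trans (≤-reflexive (*-zeroʳ T)) z≤n
triangle-bound (suc T) (suc s) = begin
  suc T * suc s                            ≡⟨ expand T s ⟩
  suc s + T + T * s                        ≤⟨ +-monoʳ-≤ (suc s + T) (triangle-bound T s) ⟩
  suc s + T + (suc s C 2 + T C 2)          ≡⟨ regroup (suc s) T (suc s C 2) (T C 2) ⟩
  (suc s + suc s C 2) + (T + T C 2)        ≡⟨ sym (cong₂ _+_ (C2-suc (suc s)) (C2-suc T)) ⟩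
  suc (suc s) C 2 + suc T C 2              ∎
  where
  open ≤-Reasoning
  expand : ∀ T s → suc T * suc s ≡ suc s + T + T * s
  expand = solve-∀
  regroup : ∀ x y a b → x + y + (a + b) ≡ (x + a) + (y + b)
  regroup = solve-∀

Capped : (n : ℕ) → (Fin n → ℕ) → Set
Capped n s = (k : Fin n) → s k ≤ n ∸ suc (toℕ k)

-- The caps are n−1, …, 0, so a capped vector sums to at most C(n,2).
Σ-capped : ∀ n (s : Fin n → ℕ) → Capped n s → Σ[ n ] s ≤ n C 2
Σ-capped zero s _ = z≤n
Σ-capped (suc n) s capped =
  ≤-trans (+-mono-≤ (capped Fin.zero) (Σ-capped n (tail s) (capped ∘ Fin.suc)))
          (≤-reflexive (sym (C2-suc n)))

Bound : ℕ → ℕ → Set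
Bound n T = (s t : Fin n → ℕ) → Capped n s → Capped n t →
            T * (Σ[ n ] s + Σ[ n ] t) ≤ Cost n s t + n * (T C 2)

bound-step : ∀ n T → T ≤ n → Bound n T → Bound (suc n) T
bound-step n T T≤n bound s t capped-s capped-t = begin
  T * ((s₀ + S) + (t₀ + U))                            ≡⟨ distrib T s₀ S t₀ U ⟩
  T * s₀ + T * t₀ + T * (S + U)
    ≤⟨ +-mono-≤ (+-mono-≤ (triangle-bound T s₀) (*-monoˡ-≤ t₀ T≤n))
                (bound (tail s) (tail t) (capped-s ∘ Fin.suc) (capped-t ∘ Fin.suc)) ⟩
  (suc s₀ C 2 + T C 2) + n * t₀ + (Cost′ + n * (T C 2)) ≡⟨ regroup (suc s₀ C 2) (T C 2) (n * t₀) Cost′ n ⟩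
  Cost (suc n) s t + suc n * (T C 2)                   ∎
  where
  open ≤-Reasoning
  s₀ t₀ S U Cost′ : ℕ
  s₀ = s Fin.zero
  t₀ = t Fin.zero
  S = Σ[ n ] (tail s)
  U = Σ[ n ] (tail t)
  Cost′ = Cost n (tail s) (tail t)
  distrib : ∀ T a S b U → T * ((a + S) + (b + U)) ≡ T * a + T * b + T * (S + U)
  distrib = solve-∀
  regroup : ∀ a c x y n → (a + c) + x + (y + n * c) ≡ (a + x) + y + suc n * c
  regroup = solve-∀

-- Level n+1 on n+1 indices follows from level n, since each of Σ s, Σ t is
-- at most C(n+1,2) and 2·C(n+1,2) + (n+1)·C(n,2) = (n+1)·C(n+1,2).
bound-full : ∀ n → Bound (suc n) n → Bound (suc n) (suc n)
bound-full n bound s t capped-s capped-t = begin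
  (X + n * X)                                   ≤⟨ +-mono-≤ (+-mono-≤ (Σ-capped (suc n) s capped-s) (Σ-capped (suc n) t capped-t))
                                                             (bound s t capped-s capped-t) ⟩
  (c + c) + (Cost (suc n) s t + suc n * (n C 2)) ≡⟨ cong (_+ (Cost (suc n) s t + suc n * (n C 2))) (C2-twice n) ⟩
  suc n * n + (Cost (suc n) s t + suc n * (n C 2)) ≡⟨ regroup n (Cost (suc n) s t) (n C 2) ⟩
  Cost (suc n) s t + suc n * (n + n C 2)        ≡⟨ cong (λ x → Cost (suc n) s t + suc n * x) (sym (C2-suc n)) ⟩
  Cost (suc n) s t + suc n * c                  ∎
  where
  open ≤-Reasoning
  X c : ℕ
  X = Σ[ suc n ] s + Σ[ suc n ] t
  c = suc n C 2
  regroup : ∀ n K d → suc n * n + (K + suc n * d) ≡ K + suc n * (n + d)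
  regroup = solve-∀

lower-bound : ∀ n T → T ≤ n → Bound n T
lower-bound zero T _ _ _ _ _ = ≤-reflexive (*-zeroʳ T)
lower-bound (suc n) T T≤1+n with m≤n⇒m<n∨m≡n T≤1+n
... | inj₁ (s≤s T≤n) = bound-step n T T≤n (lower-bound n T T≤n)
... | inj₂ refl      = bound-full n (bound-step n n ≤-refl (lower-bound n n ≤-refl))

Attains : (n m v : ℕ) → Set
Attains n m v = Σ (Fin n → ℕ) λ s → Σ (Fin n → ℕ) λ t → Feasible n m s t × Cost n s t ≡ v

capped-∷ : ∀ {n x} {s : Fin n → ℕ} → x ≤ n → Capped n s → Capped (suc n) (x Vector.∷ s)
capped-∷ x≤n _      Fin.zero    = x≤n
capped-∷ _   capped (Fin.suc k) = capped k

extend : ∀ {n m v} s₀ t₀ → s₀ ≤ n → t₀ ≤ n → Attains n m v →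
         Attains (suc n) ((s₀ + t₀) + m) ((suc s₀ C 2 + n * t₀) + v)
extend s₀ t₀ s₀≤n t₀≤n (s , t , (capped-s , capped-t , total) , cost) =
  s₀ Vector.∷ s , t₀ Vector.∷ t ,
  (capped-∷ s₀≤n capped-s , capped-∷ t₀≤n capped-t ,
   trans (interchange s₀ _ t₀ _) (cong ((s₀ + t₀) +_) total)) ,
  cong (_ +_) cost
  where
  interchange : ∀ a b c d → (a + b) + (c + d) ≡ (a + c) + (b + d)
  interchange = solve-∀

Attains-cast : ∀ {n m m′ v v′} → m ≡ m′ → v ≡ v′ → Attains n m v → Attains n m′ v′
Attains-cast = subst₂ (Attains _)

-- Every variable at its cap: total 2·C(n,2) and cost n·C(n,2).
saturated : ∀ n → Attains n (n C 2 + n C 2) (n * (n C 2))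
saturated zero = (λ ()) , (λ ()) , ((λ ()) , (λ ()) , refl) , refl
saturated (suc n) =
  Attains-cast (total-eq n) (cost-eq n)
    (extend n n ≤-refl ≤-refl (saturated n))
  where
  total-eq : ∀ n → (n + n) + (n C 2 + n C 2) ≡ suc n C 2 + suc n C 2
  total-eq n rewrite C2-suc n = regroup n (n C 2)
    where
    regroup : ∀ n c → (n + n) + (c + c) ≡ (n + c) + (n + c)
    regroup = solve-∀
  cost-eq : ∀ n → (suc n C 2 + n * n) + n * (n C 2) ≡ suc n * (suc n C 2)
  cost-eq n rewrite C2-suc n = factor n (n C 2)
    where
    factor : ∀ n c → ((n + c) + n * n) + n * c ≡ suc n * (n + c)
    factor = solve-∀

no-slack : ∀ x a → x + a ≤ x → a ≡ 0
no-slack x a x+a≤x = n≤0⇒n≡0 (+-cancelˡ-≤ x a 0 (subst (x + a ≤_) (sym (+-identityʳ x)) x+a≤x))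

-- The saturated pair on n+1 indices, in the shape used by `attain` below.
full-level : ∀ n → Attains (suc n) (suc n * n + 0) (suc n * (suc n C 2) + 0 * suc n)
full-level n = Attains-cast (trans (C2-twice n) (sym (+-identityʳ _))) (sym (+-identityʳ _)) (saturated (suc n))

-- For m = n·T + a with a ≤ n, the cost n·C(T+1,2) + a·(T+1) is attained:
-- the first index (cap n−1) takes s₀ = T when a = 0 and s₀ = T+1 otherwise,
-- spilling the rest of the slack into t₀ when the remaining caps are full.
attain : ∀ n T a → a ≤ n → n * T + a ≤ n * (n ∸ 1) →
         Attains n (n * T + a) (n * (suc T C 2) + a * suc T)
attain zero T zero _ _ = saturated zero
attain (suc n) T a a≤1+n room
  with m≤n⇒m<n∨m≡n (*-cancelˡ-≤ (suc n) (m+n≤o⇒m≤o (suc n * T) room))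
-- T equals the first cap n: only a = 0 fits, and every variable sits at its cap.
... | inj₂ refl rewrite no-slack (suc n * T) a room = full-level T
... | inj₁ T<n with a
...   | zero =
  Attains-cast (total-eq n T) (cost-eq n (suc T C 2))
    (extend T 0 (<⇒≤ T<n) z≤n (attain n T 0 z≤n room′))
  where
  room′ : n * T + 0 ≤ n * (n ∸ 1)
  room′ = ≤-trans (≤-reflexive (+-identityʳ _)) (*-monoʳ-≤ n (<⇒≤pred T<n))
  total-eq : ∀ n T → (T + 0) + (n * T + 0) ≡ suc n * T + 0
  total-eq = solve-∀
  cost-eq : ∀ n c → (c + n * 0) + (n * c + 0 * suc T) ≡ suc n * c + 0 * suc T
  cost-eq = solve-∀
...   | suc a with m≤n⇒m<n∨m≡n T<n
...     | inj₂ refl =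
  Attains-cast (total-eq T a) (cost-eq T a)
    (extend (suc T) a ≤-refl (≤-pred a≤1+n) (full-level T))
  where
  total-eq : ∀ T a → (suc T + a) + (suc T * T + 0) ≡ suc (suc T) * T + suc a
  total-eq = solve-∀
  factor : ∀ T a c → ((suc T + c) + suc T * a) + (suc T * c + 0 * suc T) ≡ suc (suc T) * c + suc a * suc T
  factor = solve-∀
  cost-eq : ∀ T a → (suc (suc T) C 2 + suc T * a) + (suc T * (suc T C 2) + 0 * suc T)
                    ≡ suc (suc T) * (suc T C 2) + suc a * suc T
  cost-eq T a rewrite C2-suc (suc T) = factor T a (suc T C 2)
...     | inj₁ 1+T<n =
  Attains-cast (total-eq n T a) (cost-eq n T a)
    (extend (suc T) 0 (<⇒≤ 1+T<n) z≤n (attain n T a (≤-pred a≤1+n) room′))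
  where
  open ≤-Reasoning
  room′ : n * T + a ≤ n * (n ∸ 1)
  room′ = begin
    n * T + a     ≤⟨ +-monoʳ-≤ (n * T) (≤-pred a≤1+n) ⟩
    n * T + n     ≡⟨ +-comm (n * T) n ⟩
    n + n * T     ≡⟨ *-suc n T ⟨
    n * suc T     ≤⟨ *-monoʳ-≤ n (<⇒≤pred 1+T<n) ⟩
    n * (n ∸ 1)   ∎
  total-eq : ∀ n T a → (suc T + 0) + (n * T + a) ≡ suc n * T + suc a
  total-eq = solve-∀
  factor : ∀ n T a c → ((suc T + c) + n * 0) + (n * c + a * suc T) ≡ suc n * c + suc a * suc T
  factor = solve-∀
  cost-eq : ∀ n T a → (suc (suc T) C 2 + n * 0) + (n * (suc T C 2) + a * suc T)
                      ≡ suc n * (suc T C 2) + suc a * suc T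
  cost-eq n T a rewrite C2-suc (suc T) = factor n T a (suc T C 2)

quotient-exact : ∀ n .{{_ : NonZero n}} r q → r < n → (r + q * n) / n ≡ q
quotient-exact n r q r<n = begin
  (r + q * n) / n      ≡⟨ +-distrib-/-∣ʳ r (divides-refl q) ⟩
  r / n + q * n / n    ≡⟨ cong₂ _+_ (m<n⇒m/n≡0 r<n) (m*n/n≡m q n) ⟩
  q                    ∎
  where open ≡-Reasoning

ceil-exact : ∀ n′ q → ⌈ suc n′ * q + 0 / suc n′ ⌉ ≡ q
ceil-exact n′ q = trans (cong (_/ suc n′) (regroup n′ q)) (quotient-exact (suc n′) n′ q ≤-refl)
  where
  regroup : ∀ n′ q → suc n′ * q + 0 + n′ ≡ n′ + q * suc n′
  regroup = solve-∀

ceil-partial : ∀ n′ q r → r < suc n′ → ⌈ suc n′ * q + suc r / suc n′ ⌉ ≡ suc q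
ceil-partial n′ q r r<n = trans (cong (_/ suc n′) (regroup n′ q r)) (quotient-exact (suc n′) r (suc q) r<n)
  where
  regroup : ∀ n′ q r → suc n′ * q + suc r + n′ ≡ r + suc q * suc n′
  regroup = solve-∀

-- A certificate that level T is optimal for total m: T ≤ n, and some
-- feasible pair has cost v with v + n·C(T,2) = T·m, matching the lower bound.
record Certificate (n m T : ℕ) : Set where
  field
    level≤n  : T ≤ n
    value    : ℕ
    attained : Attains n m value
    tight    : value + n * (T C 2) ≡ T * m

minimum : ∀ {n m T} → Certificate n m T → FIs m n (T * m ∸ ⌊ (T * T ∸ T) * n /2⌋)
minimum {n} {m} {T} record { level≤n = T≤n ; value = v ; attained = (s , t , feasible , cost) ; tight = tight }
  rewrite half-level T n = (s , t , feasible , trans cost v≡) , below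
  where
  v≡ : v ≡ T * m ∸ n * (T C 2)
  v≡ = sym (trans (cong (_∸ n * (T C 2)) (sym tight)) (m+n∸n≡m v (n * (T C 2))))
  below : (s t : Fin n → ℕ) → Feasible n m s t → T * m ∸ n * (T C 2) ≤ Cost n s t
  below s t (capped-s , capped-t , total) =
    m≤n+o⇒m∸n≤o (T * m) (n * (T C 2))
      (subst (λ x → T * x ≤ n * (T C 2) + Cost n s t) total
        (subst (T * (Σ[ n ] s + Σ[ n ] t) ≤_) (+-comm (Cost n s t) _) (lower-bound n T T≤n s t capped-s capped-t)))

tight-exact : ∀ n q → n * (suc q C 2) + 0 * suc q + n * (q C 2) ≡ q * (n * q + 0)
tight-exact n q = begin
  n * (suc q C 2) + 0 * suc q + n * (q C 2)  ≡⟨ cong (λ x → n * x + 0 * suc q + n * (q C 2)) (C2-suc q) ⟩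
  n * (q + q C 2) + 0 * suc q + n * (q C 2)  ≡⟨ collect n q (q C 2) ⟩
  n * (q C 2 + q C 2 + q)                    ≡⟨ cong (n *_) (C2-double q) ⟩
  n * (q * q)                                ≡⟨ rearrange n q ⟩
  q * (n * q + 0)                            ∎
  where
  open ≡-Reasoning
  collect : ∀ n q c → n * (q + c) + 0 * suc q + n * c ≡ n * (c + c + q)
  collect = solve-∀
  rearrange : ∀ n q → n * (q * q) ≡ q * (n * q + 0)
  rearrange = solve-∀

tight-partial : ∀ n q a → (n * (suc q C 2) + a * suc q) + n * (suc q C 2) ≡ suc q * (n * q + a)
tight-partial n q a = begin
  (n * c + a * suc q) + n * c     ≡⟨ collect n q a c ⟩
  n * (c + c) + a * suc q         ≡⟨ cong (λ x → n * x + a * suc q) (C2-twice q) ⟩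
  n * (suc q * q) + a * suc q     ≡⟨ rearrange n q a ⟩
  suc q * (n * q + a)             ∎
  where
  open ≡-Reasoning
  c : ℕ
  c = suc q C 2
  collect : ∀ n q a c → (n * c + a * suc q) + n * c ≡ n * (c + c) + a * suc q
  collect = solve-∀
  rearrange : ∀ n q a → n * (suc q * q) + a * suc q ≡ suc q * (n * q + a)
  rearrange = solve-∀

certificate-by-remainder : ∀ n′ q r → r < suc n′ → suc n′ * q + r ≤ suc n′ * n′ →
                           Certificate (suc n′) (suc n′ * q + r) ⌈ suc n′ * q + r / suc n′ ⌉
certificate-by-remainder n′ q zero _ room rewrite ceil-exact n′ q = record
  { level≤n  = m≤n⇒m≤1+n (*-cancelˡ-≤ (suc n′) (m+n≤o⇒m≤o (suc n′ * q) room))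
  ; value    = _
  ; attained = attain (suc n′) q 0 z≤n room
  ; tight    = tight-exact (suc n′) q
  }
certificate-by-remainder n′ q (suc r) r<n room rewrite ceil-partial n′ q r (<-trans (n<1+n r) r<n) = record
  { level≤n  = s≤s (<⇒≤ (*-cancelˡ-< (suc n′) q n′ (<-≤-trans (m<m+n (suc n′ * q) z<s) room)))
  ; value    = _
  ; attained = attain (suc n′) q (suc r) (<⇒≤ r<n) room
  ; tight    = tight-partial (suc n′) q (suc r)
  }

certificate : ∀ n′ m → m ≤ suc n′ * n′ → Certificate (suc n′) m ⌈ m / suc n′ ⌉
certificate n′ m room =
  subst (λ x → Certificate (suc n′) x ⌈ x / suc n′ ⌉) (sym m≡nq+r)
    (certificate-by-remainder n′ q r (m%n<n m (suc n′)) (subst (_≤ suc n′ * n′) m≡nq+r room))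
  where
  q = m / suc n′
  r = m % suc n′
  m≡nq+r : m ≡ suc n′ * q + r
  m≡nq+r = trans (m≡m%n+[m/n]*n m (suc n′)) (trans (+-comm r (q * suc n′)) (cong (_+ r) (*-comm q (suc n′))))

lemma2p2 : (n m : ℕ) → .{{_ : NonZero n}} → m ≤ n * (n ∸ 1) →
    FIs m n (⌈ m / n ⌉ * m ∸ ⌊ (⌈ m / n ⌉ * ⌈ m / n ⌉ ∸ ⌈ m / n ⌉) * n /2⌋)
lemma2p2 (suc n′) m m≤n[n-1] = minimum (certificate n′ m m≤n[n-1])
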